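{- For every integer $\ell \geq 2$, every graph $G$ with at least one vertex that is $\{P_5,K_{\ell,\ell}\}$-free has a vertex $v$ such that $\alpha(G[N[v]]) < 2\ell$.
   Context: Graphs are finite and simple. $P_5$ is the path on $5$ vertices, $K_{\ell,\ell}$ the complete bipartite graph with parts of size $\ell$. A graph is $\mathcal{F}$-free if it has no induced subgraph isomorphic to a member of $\mathcal{F}$. $N[v]$ is the closed neighborhood of $v$ (its neighbors together with $v$) and $\alpha$ denotes the independence number (maximum size of an independent set). -}

module Defs where

open import Data.Nat using (ℕ; zero; suc; _+_; _<_; _≤_; _≡ᵇ_; _<ᵇ_)
open import Data.Bool.Properties using (∨-comm)
open import Data.Fin using (Fin; toℕ)
open import Data.Bool using (Bool; true; false; _xor_; _∨_)
open import Relation.Binary.PropositionalEquality using (_≡_; _≢_; refl)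
open import Data.Product using (Σ; _×_)
open import Function.Definitions using (Injective)

record Graph (n : ℕ) : Set where
  field
    adj     : Fin n → Fin n → Bool
    sym     : ∀ i j → adj i j ≡ adj j i
    irrefl  : ∀ i → adj i i ≡ false
open Graph public

InducedSub : ∀ {k n} → Graph k → Graph n → Set
InducedSub {k} {n} H G =
  Σ (Fin k → Fin n) λ f → Injective _≡_ _≡_ f × (∀ i j → adj G (f i) (f j) ≡ adj H i j)

Free : ∀ {k n} → Graph k → Graph n → Set
Free H G = InducedSub H G → Data.Empty.⊥
  where import Data.Empty

pathAdj : ∀ {k} → Fin k → Fin k → Bool
pathAdj i j = (suc (toℕ i) ≡ᵇ toℕ j) ∨ (suc (toℕ j) ≡ᵇ toℕ i)

private
  suc≡ᵇ : ∀ m → (suc m ≡ᵇ m) ≡ false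
  suc≡ᵇ zero = refl
  suc≡ᵇ (suc m) = suc≡ᵇ m

P : (k : ℕ) → Graph k
P k = record { adj = pathAdj ; sym = λ i j → ∨-comm (suc (toℕ i) ≡ᵇ toℕ j) (suc (toℕ j) ≡ᵇ toℕ i) ; irrefl = r }
  where
  r : ∀ i → pathAdj i i ≡ false
  r i rewrite suc≡ᵇ (toℕ i) = refl

P₅ : Graph 5
P₅ = P 5

-- Complete bipartite graph K_{ℓ,ℓ} on Fin (ℓ + ℓ): parts {0..ℓ-1}, {ℓ..2ℓ-1};
-- i ~ j iff exactly one of them lies in the first part.
kbAdj : ∀ ℓ → Fin (ℓ + ℓ) → Fin (ℓ + ℓ) → Bool
kbAdj ℓ i j = (toℕ i <ᵇ ℓ) xor (toℕ j <ᵇ ℓ)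

K : (ℓ : ℕ) → Graph (ℓ + ℓ)
K ℓ = record { adj = kbAdj ℓ ; sym = λ i j → xor-comm (toℕ i <ᵇ ℓ) (toℕ j <ᵇ ℓ) ; irrefl = λ i → xor-same (toℕ i <ᵇ ℓ) }
  where
  open import Data.Bool.Properties using (xor-same)
  xor-comm : ∀ a b → a xor b ≡ b xor a
  xor-comm false false = Relation.Binary.PropositionalEquality.refl
  xor-comm false true  = Relation.Binary.PropositionalEquality.refl
  xor-comm true  false = Relation.Binary.PropositionalEquality.refl
  xor-comm true  true  = Relation.Binary.PropositionalEquality.refl

InClosedNbhd : ∀ {n} → Graph n → Fin n → Fin n → Set
InClosedNbhd G v u = (u ≡ v) Data.Sum.⊎ (adj G v u ≡ true)
  where import Data.Sum

HasIndepSetIn : ∀ {n} → Graph n → (Fin n → Set) → ℕ → Set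
HasIndepSetIn {n} G S k =
  Σ (Fin k → Fin n) λ f → Injective _≡_ _≡_ f × (∀ i → S (f i)) × (∀ i j → adj G (f i) (f j) ≡ false)

αInduced<_ : ∀ {n} → (G : Graph n) → (Fin n → Set) → ℕ → Set
αInduced<_ G S m = HasIndepSetIn G S m → Data.Empty.⊥
  where import Data.Empty

{-# OPTIONS --safe #-}
module Submission where

-- Fix a maximum independent set I and a vertex u ∈ I, and suppose N[u] contains an
-- independent set of 2ℓ ≥ 2 vertices; it then avoids u, so it is a set D ⊆ N(u).
-- For w ∈ D let N_I(w) = I ∩ N(w). If neither of N_I(w), N_I(w′) contained the other,
-- then x ∈ N_I(w) ∖ N_I(w′) and y ∈ N_I(w′) ∖ N_I(w) would give an induced path
-- x w u w′ y; so in a P₅-free graph these sets form a chain. The vertices of D with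
-- |N_I(w)| < ℓ have all their I-neighbours inside the largest such set X, so together
-- with I ∖ X they are independent: by maximality of I there are at most |X| < ℓ of them.
-- Hence at least ℓ vertices of D have |N_I(w)| ≥ ℓ, and all of them are complete to the
-- smallest of these sets, which yields an induced K_{ℓ,ℓ}.

open import Data.Bool using (true; false)
open import Data.Bool.Properties using (¬-not; T-≡) renaming (_≟_ to _≟ᵇ_)
open import Data.Empty using (⊥-elim)
open import Data.Fin as Fin using (Fin; zero; suc; toℕ; fromℕ<; splitAt; join)
open import Data.Fin.Patterns using (0F; 1F; 2F; 3F; 4F)
open import Data.Fin.Properties
  using (any?; all?; _≟_; suc-injective; 0≢1+n; <-cmp; join-splitAt; splitAt-<; splitAt-≥)
open import Data.Fin.Subset
  using (Subset; inside; outside; _∈_; _∉_; _⊆_; _∪_; _∩_; ∁; _-_; ⊥; ⁅_⁆; ∣_∣; Nonempty; Empty)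
open import Data.Fin.Subset.Properties
  using ( _∈?_; nonempty?; anySubset?; Empty-unique; ∉⊥; ∣⊥∣≡0; ∣p∣≤n; ∣⁅x⁆∣≡1; x∈⁅y⁆⇒x≡y
        ; p⊆q⇒∣p∣≤∣q∣; p⊂q⇒∣p∣<∣q∣; x∈p∧x≢y⇒x∈p-y; x∈p⇒∣p-x∣<∣p∣
        ; x∈p∩q⁺; x∈p∩q⁻; p∩q⊆p; x∈p∪q⁺; x∈p∪q⁻; x∈∁p⇒x∉p; x∉p⇒x∈∁p )
open import Data.Nat using (ℕ; zero; suc; _+_; _∸_; _≤_; _<_; z≤n; s≤s; _<ᵇ_; _≤?_; _<?_)
open import Data.Nat.Properties
  using ( ≤-refl; ≤-trans; ≤-<-trans; <⇒≤; ≮⇒≥; ≰⇒>; <⇒≱; ≤⇒≯; >⇒≢; m≤m+n; +-comm; +-suc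
        ; +-identityʳ; +-monoʳ-≤; +-cancelʳ-≤; ∸-cancelʳ-≤; <⇒<ᵇ; <ᵇ⇒<; module ≤-Reasoning )
open import Data.Product using (Σ; ∃; _×_; _,_; proj₁; proj₂)
open import Data.Sum using (_⊎_; inj₁; inj₂; [_,_]′)
open import Data.Vec using (_∷_; []; tabulate; here; there)
open import Data.Vec.Properties using (lookup∘tabulate; lookup⇒[]=; []=⇒lookup)
open import Function using (_∘_; const; Injective; Equivalence)
open import Level using (0ℓ)
open import Relation.Binary.Definitions using (tri<; tri≈; tri>)
open import Relation.Binary.PropositionalEquality
  using (_≡_; _≢_; refl; sym; trans; cong; subst; module ≡-Reasoning)
open import Relation.Nullary using (Dec; yes; no; does; ¬?; contradiction)
open import Relation.Nullary.Decidable
  using (_×-dec_; _→-dec_; map′; dec-true; decidable-stable; from-yes)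
open import Relation.Unary using (Pred; Decidable)

open import Defs renaming (sym to adj-sym)

private
  variable
    k m n : ℕ

Searchable : Set → Set₁
Searchable A = ∀ {P : Pred A 0ℓ} → Decidable P → Dec (∃ P)

module _ {A : Set} (search : Searchable A) {P : Pred A 0ℓ} (P? : Decidable P) where

  argmin : (f : A → ℕ) → ∀ {a} → P a → ∃ λ m → P m × (∀ {b} → P b → f m ≤ f b)
  argmin f {a} pa = descend (suc (f a)) ≤-refl pa
    where
    descend : ∀ fuel {a} → f a < fuel → P a → ∃ λ m → P m × (∀ {b} → P b → f m ≤ f b)
    descend (suc fuel) {a} (s≤s fa≤fuel) pa with search (λ b → P? b ×-dec f b <? f a)
    ... | yes (b , pb , fb<fa) = descend fuel (≤-trans fb<fa fa≤fuel) pb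
    ... | no ¬smaller          = a , pa , λ pb → ≮⇒≥ (λ fb<fa → ¬smaller (_ , pb , fb<fa))

  argmax : (f : A → ℕ) {B : ℕ} → (∀ a → f a ≤ B) →
           ∀ {a} → P a → ∃ λ m → P m × (∀ {b} → P b → f b ≤ f m)
  argmax f {B} f≤B pa with argmin (λ a → B ∸ f a) pa
  ... | m , pm , least = m , pm , λ pb → ∸-cancelʳ-≤ (f≤B _) (least pb)

filter : {P : Pred (Fin n) 0ℓ} → Decidable P → Subset n
filter P? = tabulate (does ∘ P?)

module _ {P : Pred (Fin n) 0ℓ} (P? : Decidable P) {x : Fin n} where

  ∈-filter⁺ : P x → x ∈ filter P?
  ∈-filter⁺ px = lookup⇒[]= x _ (trans (lookup∘tabulate (does ∘ P?) x) (dec-true (P? x) px))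

  ∈-filter⁻ : x ∈ filter P? → P x
  ∈-filter⁻ x∈ with P? x | trans (sym (lookup∘tabulate (does ∘ P?) x)) ([]=⇒lookup x∈)
  ... | yes px | _  = px
  ... | no _   | ()

∣p∪q∣+∣p∩q∣≡∣p∣+∣q∣ : (p q : Subset n) → ∣ p ∪ q ∣ + ∣ p ∩ q ∣ ≡ ∣ p ∣ + ∣ q ∣
∣p∪q∣+∣p∩q∣≡∣p∣+∣q∣ []            []            = refl
∣p∪q∣+∣p∩q∣≡∣p∣+∣q∣ (outside ∷ p) (outside ∷ q) = ∣p∪q∣+∣p∩q∣≡∣p∣+∣q∣ p q
∣p∪q∣+∣p∩q∣≡∣p∣+∣q∣ (inside  ∷ p) (outside ∷ q) = cong suc (∣p∪q∣+∣p∩q∣≡∣p∣+∣q∣ p q)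
∣p∪q∣+∣p∩q∣≡∣p∣+∣q∣ (outside ∷ p) (inside  ∷ q) =
  trans (cong suc (∣p∪q∣+∣p∩q∣≡∣p∣+∣q∣ p q)) (sym (+-suc ∣ p ∣ ∣ q ∣))
∣p∪q∣+∣p∩q∣≡∣p∣+∣q∣ (inside  ∷ p) (inside  ∷ q) = cong suc (begin
  ∣ p ∪ q ∣ + suc ∣ p ∩ q ∣ ≡⟨ +-suc ∣ p ∪ q ∣ ∣ p ∩ q ∣ ⟩
  suc (∣ p ∪ q ∣ + ∣ p ∩ q ∣) ≡⟨ cong suc (∣p∪q∣+∣p∩q∣≡∣p∣+∣q∣ p q) ⟩
  suc (∣ p ∣ + ∣ q ∣)         ≡⟨ +-suc ∣ p ∣ ∣ q ∣ ⟨
  ∣ p ∣ + suc ∣ q ∣           ∎)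
  where open ≡-Reasoning

Empty⇒∣p∣≡0 : {p : Subset n} → Empty p → ∣ p ∣ ≡ 0
Empty⇒∣p∣≡0 {n} p-empty = trans (cong ∣_∣ (Empty-unique p-empty)) (∣⊥∣≡0 n)

∣p∣>0⇒Nonempty : {p : Subset n} → 0 < ∣ p ∣ → Nonempty p
∣p∣>0⇒Nonempty {p = p} 0<∣p∣ with nonempty? p
... | yes p-nonempty = p-nonempty
... | no  p-empty    = contradiction (Empty⇒∣p∣≡0 p-empty) (>⇒≢ 0<∣p∣)

p⊆q∪r⇒∣p∣≤∣q∣+∣r∣ : {p q r : Subset n} → p ⊆ q ∪ r → ∣ p ∣ ≤ ∣ q ∣ + ∣ r ∣
p⊆q∪r⇒∣p∣≤∣q∣+∣r∣ {p = p} {q} {r} p⊆q∪r = begin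
  ∣ p ∣                 ≤⟨ p⊆q⇒∣p∣≤∣q∣ p⊆q∪r ⟩
  ∣ q ∪ r ∣             ≤⟨ m≤m+n ∣ q ∪ r ∣ ∣ q ∩ r ∣ ⟩
  ∣ q ∪ r ∣ + ∣ q ∩ r ∣ ≡⟨ ∣p∪q∣+∣p∩q∣≡∣p∣+∣q∣ q r ⟩
  ∣ q ∣ + ∣ r ∣         ∎
  where open ≤-Reasoning

Empty[p∩q]⇒∣p∪q∣≡∣p∣+∣q∣ : {p q : Subset n} → Empty (p ∩ q) → ∣ p ∪ q ∣ ≡ ∣ p ∣ + ∣ q ∣
Empty[p∩q]⇒∣p∪q∣≡∣p∣+∣q∣ {p = p} {q} disjoint = begin
  ∣ p ∪ q ∣             ≡⟨ +-identityʳ ∣ p ∪ q ∣ ⟨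
  ∣ p ∪ q ∣ + 0         ≡⟨ cong (∣ p ∪ q ∣ +_) (Empty⇒∣p∣≡0 disjoint) ⟨
  ∣ p ∪ q ∣ + ∣ p ∩ q ∣ ≡⟨ ∣p∪q∣+∣p∩q∣≡∣p∣+∣q∣ p q ⟩
  ∣ p ∣ + ∣ q ∣         ∎
  where open ≡-Reasoning

p⊆q∧∣q∣≤∣p∣⇒q⊆p : {p q : Subset n} → p ⊆ q → ∣ q ∣ ≤ ∣ p ∣ → q ⊆ p
p⊆q∧∣q∣≤∣p∣⇒q⊆p {p = p} p⊆q ∣q∣≤∣p∣ {x} x∈q with x ∈? p
... | yes x∈p = x∈p
... | no  x∉p = contradiction (p⊂q⇒∣p∣<∣q∣ (p⊆q , x , x∈q , x∉p)) (≤⇒≯ ∣q∣≤∣p∣)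

⊆⊎∃∉ : (p q : Subset n) → p ⊆ q ⊎ ∃ λ x → x ∈ p × x ∉ q
⊆⊎∃∉ p q with any? (λ x → x ∈? p ×-dec ¬? (x ∈? q))
... | yes escapee   = inj₂ escapee
... | no  ¬escapee  = inj₁ λ {x} x∈p → decidable-stable (x ∈? q) (λ x∉q → ¬escapee (x , x∈p , x∉q))

Chain : Subset n → (Fin n → Subset m) → Set
Chain A S = ∀ {w w′} → w ∈ A → w′ ∈ A → S w ⊆ S w′ ⊎ S w′ ⊆ S w

module _ {A : Subset n} {S : Fin n → Subset m} (chain : Chain A S) where

  chain-greatest : Nonempty A → ∃ λ p → p ∈ A × (∀ {w} → w ∈ A → S w ⊆ S p)
  chain-greatest (a , a∈A) with argmax any? (_∈? A) (∣_∣ ∘ S) (∣p∣≤n ∘ S) a∈A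
  ... | p , p∈A , largest = p , p∈A , below
    where
    below : ∀ {w} → w ∈ A → S w ⊆ S p
    below w∈A with chain w∈A p∈A
    ... | inj₁ Sw⊆Sp = Sw⊆Sp
    ... | inj₂ Sp⊆Sw = p⊆q∧∣q∣≤∣p∣⇒q⊆p Sp⊆Sw (largest w∈A)

  chain-least : Nonempty A → ∃ λ q → q ∈ A × (∀ {w} → w ∈ A → S q ⊆ S w)
  chain-least (a , a∈A) with argmin any? (_∈? A) (∣_∣ ∘ S) a∈A
  ... | q , q∈A , smallest = q , q∈A , above
    where
    above : ∀ {w} → w ∈ A → S q ⊆ S w
    above w∈A with chain w∈A q∈A
    ... | inj₁ Sw⊆Sq = p⊆q∧∣q∣≤∣p∣⇒q⊆p Sw⊆Sq (smallest w∈A)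
    ... | inj₂ Sq⊆Sw = Sq⊆Sw

_↪_ : ℕ → Subset n → Set
_↪_ {n} k p = Σ (Fin k → Fin n) λ f → Injective _≡_ _≡_ f × (∀ i → f i ∈ p)

↪⇒≤∣p∣ : {p : Subset n} → k ↪ p → k ≤ ∣ p ∣
↪⇒≤∣p∣ {k = zero}  _                  = z≤n
↪⇒≤∣p∣ {k = suc k} (f , f-inj , f∈p) = ≤-<-trans (↪⇒≤∣p∣ rest) (x∈p⇒∣p-x∣<∣p∣ (f∈p zero))
  where
  rest : k ↪ (_ - f zero)
  rest = f ∘ suc , suc-injective ∘ f-inj , λ i → x∈p∧x≢y⇒x∈p-y (f∈p (suc i)) (0≢1+n ∘ sym ∘ f-inj)

≤∣p∣⇒↪ : (p : Subset n) → k ≤ ∣ p ∣ → k ↪ p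
≤∣p∣⇒↪ {k = zero}  _             _            = (λ ()) , (λ { {()} }) , λ ()
≤∣p∣⇒↪ {k = suc k} []            ()
≤∣p∣⇒↪ {k = suc k} (outside ∷ p) k<∣p∣        with ≤∣p∣⇒↪ p k<∣p∣
... | f , f-inj , f∈p = suc ∘ f , f-inj ∘ suc-injective , there ∘ f∈p
≤∣p∣⇒↪ {k = suc k} (inside  ∷ p) (s≤s k≤∣p∣) with ≤∣p∣⇒↪ p k≤∣p∣
... | f , f-inj , f∈p = g , g-inj , g∈p
  where
  g : Fin (suc k) → Fin _
  g zero    = zero
  g (suc i) = suc (f i)
  g-inj : Injective _≡_ _≡_ g
  g-inj {zero}  {zero}  _  = refl
  g-inj {suc i} {suc j} gi≡gj = cong suc (f-inj (suc-injective gi≡gj))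
  g∈p : ∀ i → g i ∈ inside ∷ p
  g∈p zero    = here
  g∈p (suc i) = there (f∈p i)

module _ (f : Fin k → Fin n) where

  ∈-image? : Decidable (λ x → ∃ λ i → f i ≡ x)
  ∈-image? x = any? (λ i → f i ≟ x)

  image : Subset n
  image = filter ∈-image?

  ∈-image⁺ : ∀ i → f i ∈ image
  ∈-image⁺ i = ∈-filter⁺ ∈-image? (i , refl)

  ∈-image⁻ : ∀ {x} → x ∈ image → ∃ λ i → f i ≡ x
  ∈-image⁻ = ∈-filter⁻ ∈-image?

distinct-from : 2 ≤ k → (i : Fin k) → ∃ λ j → j ≢ i
distinct-from (s≤s (s≤s z≤n)) zero    = 1F , λ ()
distinct-from (s≤s (s≤s z≤n)) (suc i) = 0F , λ ()

<ᵇ-splitAt : ∀ m (i : Fin (m + n)) → (toℕ i <ᵇ m) ≡ [ const true , const false ]′ (splitAt m i)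
<ᵇ-splitAt m i with toℕ i <? m
... | yes i<m rewrite splitAt-< m i i<m = Equivalence.to T-≡ (<⇒<ᵇ i<m)
... | no  i≮m rewrite splitAt-≥ m i (≮⇒≥ i≮m) = ¬-not (i≮m ∘ <ᵇ⇒< (toℕ i) m ∘ Equivalence.from T-≡)

module _ (G : Graph n) where

  Independent : Subset n → Set
  Independent p = ∀ {x y} → x ∈ p → y ∈ p → adj G x y ≡ false

  independent? : Decidable Independent
  independent? p = map′ (λ h {x} {y} → h x y) (λ h x y → h)
    (all? λ x → all? λ y → (x ∈? p) →-dec (y ∈? p) →-dec (adj G x y ≟ᵇ false))

  IsMaximum : Subset n → Set
  IsMaximum I = Independent I × (∀ {J} → Independent J → ∣ J ∣ ≤ ∣ I ∣)

  maximum-independent-set : ∃ IsMaximum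
  maximum-independent-set = argmax anySubset? independent? ∣_∣ ∣p∣≤n {⊥} (λ x∈⊥ _ → contradiction x∈⊥ ∉⊥)

  maximum-nonempty : {I : Subset n} → IsMaximum I → Fin n → Nonempty I
  maximum-nonempty {I} (_ , largest) v =
    ∣p∣>0⇒Nonempty (subst (_≤ ∣ I ∣) (∣⁅x⁆∣≡1 v) (largest singleton-independent))
    where
    singleton-independent : Independent ⁅ v ⁆
    singleton-independent x∈⁅v⁆ y∈⁅v⁆
      rewrite x∈⁅y⁆⇒x≡y v x∈⁅v⁆ | x∈⁅y⁆⇒x≡y v y∈⁅v⁆ = irrefl G v

  N : Fin n → Subset n
  N v = filter (λ x → adj G v x ≟ᵇ true)

  ∈N⁺ : ∀ {v x} → adj G v x ≡ true → x ∈ N v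
  ∈N⁺ {v} = ∈-filter⁺ (λ x → adj G v x ≟ᵇ true)

  ∈N⁻ : ∀ {v x} → x ∈ N v → adj G v x ≡ true
  ∈N⁻ {v} = ∈-filter⁻ (λ x → adj G v x ≟ᵇ true)

  adjacent⇒≢ : ∀ {x y} → adj G x y ≡ true → x ≢ y
  adjacent⇒≢ {x} x~y refl with trans (sym (irrefl G x)) x~y
  ... | ()

  exchange-bound : ∀ {I J X} → IsMaximum I → Independent J → (∀ {x} → x ∈ J → x ∉ I) →
                   (∀ {x y} → x ∈ J → y ∈ I → adj G x y ≡ true → y ∈ X) → ∣ J ∣ ≤ ∣ X ∣
  exchange-bound {I} {J} {X} (I-ind , I-largest) J-ind J∉I attached =
    +-cancelʳ-≤ _ _ _ (begin
      ∣ J ∣ + ∣ I∖X ∣   ≡⟨ Empty[p∩q]⇒∣p∪q∣≡∣p∣+∣q∣ disjoint ⟨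
      ∣ J ∪ I∖X ∣       ≤⟨ I-largest swapped-independent ⟩
      ∣ I ∣             ≤⟨ p⊆q∪r⇒∣p∣≤∣q∣+∣r∣ I⊆I∖X∪X ⟩
      ∣ I∖X ∣ + ∣ X ∣   ≡⟨ +-comm _ ∣ X ∣ ⟩
      ∣ X ∣ + ∣ I∖X ∣   ∎)
    where
    open ≤-Reasoning
    I∖X : Subset n
    I∖X = I ∩ ∁ X
    disjoint : Empty (J ∩ I∖X)
    disjoint (x , x∈) with x∈p∩q⁻ J _ x∈
    ... | x∈J , x∈I∖X = J∉I x∈J (proj₁ (x∈p∩q⁻ I _ x∈I∖X))
    unattached : ∀ {x y} → x ∈ J → y ∈ I∖X → adj G x y ≡ false
    unattached x∈J y∈I∖X with x∈p∩q⁻ I _ y∈I∖X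
    ... | y∈I , y∈∁X = ¬-not λ x~y → x∈∁p⇒x∉p y∈∁X (attached x∈J y∈I x~y)
    swapped-independent : Independent (J ∪ I∖X)
    swapped-independent {x} {y} x∈ y∈ with x∈p∪q⁻ J _ x∈ | x∈p∪q⁻ J _ y∈
    ... | inj₁ x∈J    | inj₁ y∈J    = J-ind x∈J y∈J
    ... | inj₁ x∈J    | inj₂ y∈I∖X  = unattached x∈J y∈I∖X
    ... | inj₂ x∈I∖X  | inj₁ y∈J    = trans (adj-sym G x y) (unattached y∈J x∈I∖X)
    ... | inj₂ x∈I∖X  | inj₂ y∈I∖X  = I-ind (p∩q⊆p I _ x∈I∖X) (p∩q⊆p I _ y∈I∖X)
    I⊆I∖X∪X : I ⊆ I∖X ∪ X
    I⊆I∖X∪X {x} x∈I with x ∈? X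
    ... | yes x∈X = x∈p∪q⁺ (inj₂ x∈X)
    ... | no  x∉X = x∈p∪q⁺ (inj₁ (x∈p∩q⁺ (x∈I , x∉p⇒x∈∁p x∉X)))

TwinFree : Graph k → Set
TwinFree H = ∀ i j → (∀ v → adj H i v ≡ adj H j v) → i ≡ j

module _ (H : Graph k) (G : Graph n) where

  twin-free-embedding : TwinFree H → (f : Fin k → Fin n) →
                        (∀ i j → adj G (f i) (f j) ≡ adj H i j) → InducedSub H G
  twin-free-embedding twin-free f f-adj = f , f-inj , f-adj
    where
    f-inj : Injective _≡_ _≡_ f
    f-inj {i} {j} fi≡fj = twin-free i j λ v → begin
      adj H i v         ≡⟨ f-adj i v ⟨
      adj G (f i) (f v) ≡⟨ cong (λ x → adj G x (f v)) fi≡fj ⟩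
      adj G (f j) (f v) ≡⟨ f-adj j v ⟩
      adj H j v         ∎
      where open ≡-Reasoning

  adj-from-upper : (f : Fin k → Fin n) → (∀ {i j} → i Fin.< j → adj G (f i) (f j) ≡ adj H i j) →
                   ∀ i j → adj G (f i) (f j) ≡ adj H i j
  adj-from-upper f upper i j with <-cmp i j
  ... | tri< i<j _ _    = upper i<j
  ... | tri≈ _ refl _   = trans (irrefl G (f i)) (sym (irrefl H i))
  ... | tri> _ _ j<i    = trans (adj-sym G (f i) (f j)) (trans (upper j<i) (adj-sym H j i))

P₅-twin-free : TwinFree P₅
P₅-twin-free = from-yes (all? {n = 5} λ i → all? λ j → all? (λ v → pathAdj i v ≟ᵇ pathAdj j v) →-dec i ≟ j)

module _ (G : Graph n) where

  induced-P₅ : ∀ {a b c d e} →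
    adj G a b ≡ true → adj G b c ≡ true → adj G c d ≡ true → adj G d e ≡ true →
    adj G a c ≡ false → adj G a d ≡ false → adj G a e ≡ false →
    adj G b d ≡ false → adj G b e ≡ false → adj G c e ≡ false → InducedSub P₅ G
  induced-P₅ {a} {b} {c} {d} {e} ab bc cd de ac ad ae bd be ce =
    twin-free-embedding P₅ G P₅-twin-free path (adj-from-upper P₅ G path upper)
    where
    path : Fin 5 → Fin n
    path 0F = a
    path 1F = b
    path 2F = c
    path 3F = d
    path 4F = e
    upper : ∀ {i j} → i Fin.< j → adj G (path i) (path j) ≡ pathAdj i j
    upper {0F} {1F} _ = ab
    upper {0F} {2F} _ = ac
    upper {0F} {3F} _ = ad
    upper {0F} {4F} _ = ae
    upper {1F} {2F} _ = bc
    upper {1F} {3F} _ = bd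
    upper {1F} {4F} _ = be
    upper {2F} {3F} _ = cd
    upper {2F} {4F} _ = ce
    upper {3F} {4F} _ = de
    upper {_}                   {0F} ()
    upper {suc _}               {1F} (s≤s ())
    upper {suc (suc _)}         {2F} (s≤s (s≤s ()))
    upper {suc (suc (suc _))}   {3F} (s≤s (s≤s (s≤s ())))
    upper {4F}                  {4F} (s≤s (s≤s (s≤s (s≤s ()))))

  induced-K : ∀ ℓ (X Y : Fin ℓ → Fin n) → Injective _≡_ _≡_ X → Injective _≡_ _≡_ Y →
    (∀ a b → adj G (X a) (X b) ≡ false) → (∀ a b → adj G (Y a) (Y b) ≡ false) →
    (∀ a b → adj G (X a) (Y b) ≡ true) → InducedSub (K ℓ) G
  induced-K ℓ X Y X-inj Y-inj X-ind Y-ind X~Y = embed , embed-inj , embed-adj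
    where
    embed : Fin (ℓ + ℓ) → Fin n
    embed = [ X , Y ]′ ∘ splitAt ℓ
    embed-adj : ∀ i j → adj G (embed i) (embed j) ≡ kbAdj ℓ i j
    embed-adj i j rewrite <ᵇ-splitAt ℓ i | <ᵇ-splitAt ℓ j with splitAt ℓ i | splitAt ℓ j
    ... | inj₁ a | inj₁ b = X-ind a b
    ... | inj₁ a | inj₂ b = X~Y a b
    ... | inj₂ a | inj₁ b = trans (adj-sym G (Y a) (X b)) (X~Y b a)
    ... | inj₂ a | inj₂ b = Y-ind a b
    [X,Y]-inj : ∀ {s t} → [ X , Y ]′ s ≡ [ X , Y ]′ t → s ≡ t
    [X,Y]-inj {inj₁ a} {inj₁ b} Xa≡Xb = cong inj₁ (X-inj Xa≡Xb)
    [X,Y]-inj {inj₁ a} {inj₂ b} Xa≡Yb = contradiction Xa≡Yb (adjacent⇒≢ G (X~Y a b))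
    [X,Y]-inj {inj₂ a} {inj₁ b} Ya≡Xb = contradiction (sym Ya≡Xb) (adjacent⇒≢ G (X~Y b a))
    [X,Y]-inj {inj₂ a} {inj₂ b} Ya≡Yb = cong inj₂ (Y-inj Ya≡Yb)
    embed-inj : Injective _≡_ _≡_ embed
    embed-inj {i} {j} embed-i≡embed-j = begin
      i                       ≡⟨ join-splitAt ℓ ℓ i ⟨
      join ℓ ℓ (splitAt ℓ i)  ≡⟨ cong (join ℓ ℓ) ([X,Y]-inj {splitAt ℓ i} {splitAt ℓ j} embed-i≡embed-j) ⟩
      join ℓ ℓ (splitAt ℓ j)  ≡⟨ join-splitAt ℓ ℓ j ⟩
      j                       ∎
      where open ≡-Reasoning

  complete-bipartite⇒K : ∀ {ℓ A B} → Independent G A → Independent G B →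
    (∀ {x y} → x ∈ A → y ∈ B → adj G x y ≡ true) → ℓ ≤ ∣ A ∣ → ℓ ≤ ∣ B ∣ → InducedSub (K ℓ) G
  complete-bipartite⇒K {ℓ} {A} {B} A-ind B-ind A~B ℓ≤∣A∣ ℓ≤∣B∣
    with ≤∣p∣⇒↪ A ℓ≤∣A∣ | ≤∣p∣⇒↪ B ℓ≤∣B∣
  ... | X , X-inj , X∈A | Y , Y-inj , Y∈B = induced-K ℓ X Y X-inj Y-inj
    (λ a b → A-ind (X∈A a) (X∈A b)) (λ a b → B-ind (Y∈B a) (Y∈B b)) (λ a b → A~B (X∈A a) (Y∈B b))

  closed⇒open : ∀ {u} → 2 ≤ k → HasIndepSetIn G (InClosedNbhd G u) k →
                HasIndepSetIn G (λ x → adj G u x ≡ true) k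
  closed⇒open {u = u} 2≤k (D , D-inj , D∈N[u] , D-ind) = D , D-inj , u~D , D-ind
    where
    u~D : ∀ i → adj G u (D i) ≡ true
    u~D i with D∈N[u] i
    ... | inj₂ u~Di = u~Di
    ... | inj₁ Di≡u with distinct-from 2≤k i
    ...   | j , j≢i with D∈N[u] j
    ...     | inj₁ Dj≡u = contradiction (D-inj (trans Dj≡u (sym Di≡u))) j≢i
    ...     | inj₂ u~Dj with trans (sym u~Dj) (subst (λ v → adj G v (D j) ≡ false) Di≡u (D-ind i j))
    ...       | ()

  independent-family⇒subset : ∀ {S : Fin n → Set} → HasIndepSetIn G S k →
    ∃ λ D → Independent G D × (∀ {x} → x ∈ D → S x) × k ≤ ∣ D ∣
  independent-family⇒subset {k = k} {S = S} (f , f-inj , f∈S , f-ind) =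
    image f , image-ind , image⊆S , k≤∣image∣
    where
    image-ind : Independent G (image f)
    image-ind x∈ y∈ with ∈-image⁻ f x∈ | ∈-image⁻ f y∈
    ... | i , refl | j , refl = f-ind i j
    image⊆S : ∀ {x} → x ∈ image f → S x
    image⊆S x∈ with ∈-image⁻ f x∈
    ... | i , refl = f∈S i
    k≤∣image∣ : k ≤ ∣ image f ∣
    k≤∣image∣ = ↪⇒≤∣p∣ (f , f-inj , ∈-image⁺ f)

module MaximumIndependentSet (G : Graph n) (P₅-free : Free P₅ G)
                              {I : Subset n} (I-max : IsMaximum G I) {u : Fin n} (u∈I : u ∈ I) where

  I-ind : Independent G I
  I-ind = proj₁ I-max

  NI : Fin n → Subset n
  NI w = I ∩ N G w

  ∈NI⁻ : ∀ {w x} → x ∈ NI w → x ∈ I × adj G w x ≡ true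
  ∈NI⁻ {w} x∈NIw with x∈p∩q⁻ I (N G w) x∈NIw
  ... | x∈I , x∈Nw = x∈I , ∈N⁻ G x∈Nw

  ∉NI⇒≁ : ∀ {w x} → x ∈ I → x ∉ NI w → adj G w x ≡ false
  ∉NI⇒≁ x∈I x∉NIw = ¬-not λ w~x → x∉NIw (x∈p∩q⁺ (x∈I , ∈N⁺ G w~x))

  ∈N⇒∉I : ∀ {w} → w ∈ N G u → w ∉ I
  ∈N⇒∉I w∈Nu w∈I with trans (sym (∈N⁻ G w∈Nu)) (I-ind u∈I w∈I)
  ... | ()

  nested : ∀ {J} → Independent G J → J ⊆ N G u → Chain J NI
  nested J-ind J⊆Nu {w} {w′} w∈J w′∈J with ⊆⊎∃∉ (NI w) (NI w′) | ⊆⊎∃∉ (NI w′) (NI w)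
  ... | inj₁ NIw⊆NIw′ | _               = inj₁ NIw⊆NIw′
  ... | inj₂ _        | inj₁ NIw′⊆NIw   = inj₂ NIw′⊆NIw
  ... | inj₂ (x , x∈NIw , x∉NIw′) | inj₂ (y , y∈NIw′ , y∉NIw)
    with ∈NI⁻ x∈NIw | ∈NI⁻ y∈NIw′ | ∈N⁻ G (J⊆Nu w∈J) | ∈N⁻ G (J⊆Nu w′∈J)
  ... | x∈I , w~x | y∈I , w′~y | u~w | u~w′ =
    -- the induced path is x w u w′ y
    ⊥-elim (P₅-free (induced-P₅ G
      (trans (adj-sym G x w) w~x) (trans (adj-sym G w u) u~w) u~w′ w′~y
      (I-ind x∈I u∈I) (trans (adj-sym G x w′) (∉NI⇒≁ x∈I x∉NIw′)) (I-ind x∈I y∈I)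
      (J-ind w∈J w′∈J) (∉NI⇒≁ y∈I y∉NIw) (I-ind u∈I y∈I)))

  ∣NI∣≤k⇒∣J∣≤k : ∀ {J} → Independent G J → J ⊆ N G u → (∀ {w} → w ∈ J → ∣ NI w ∣ ≤ k) → ∣ J ∣ ≤ k
  ∣NI∣≤k⇒∣J∣≤k {J = J} J-ind J⊆Nu ∣NI∣≤k with nonempty? J
  ... | no  J-empty    = subst (_≤ _) (sym (Empty⇒∣p∣≡0 J-empty)) z≤n
  ... | yes J-nonempty with chain-greatest (nested J-ind J⊆Nu) J-nonempty
  ...   | p , p∈J , NI⊆NIp = ≤-trans (exchange-bound G I-max J-ind (∈N⇒∉I ∘ J⊆Nu) attached) (∣NI∣≤k p∈J)
    where
    attached : ∀ {x y} → x ∈ J → y ∈ I → adj G x y ≡ true → y ∈ NI p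
    attached x∈J y∈I x~y = NI⊆NIp x∈J (x∈p∩q⁺ (y∈I , ∈N⁺ G x~y))

  ℓ≤∣NI∣⇒K : ∀ {ℓ J} → 1 ≤ ℓ → Independent G J → J ⊆ N G u → ℓ ≤ ∣ J ∣ →
             (∀ {w} → w ∈ J → ℓ ≤ ∣ NI w ∣) → InducedSub (K ℓ) G
  ℓ≤∣NI∣⇒K {J = J} 1≤ℓ J-ind J⊆Nu ℓ≤∣J∣ ℓ≤∣NI∣
    with chain-least (nested J-ind J⊆Nu) (∣p∣>0⇒Nonempty (≤-trans 1≤ℓ ℓ≤∣J∣))
  ... | q , q∈J , NIq⊆NI = complete-bipartite⇒K G NIq-ind J-ind NIq~J (ℓ≤∣NI∣ q∈J) ℓ≤∣J∣
    where
    NIq-ind : Independent G (NI q)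
    NIq-ind x∈ y∈ = I-ind (p∩q⊆p I _ x∈) (p∩q⊆p I _ y∈)
    NIq~J : ∀ {x y} → x ∈ NI q → y ∈ J → adj G x y ≡ true
    NIq~J {x} {y} x∈NIq y∈J = trans (adj-sym G x y) (proj₂ (∈NI⁻ (NIq⊆NI y∈J x∈NIq)))

  independent⊆N⇒∣D∣<ℓ+ℓ : ∀ {ℓ D} → Free (K ℓ) G → 1 ≤ ℓ →
                           Independent G D → D ⊆ N G u → ∣ D ∣ < ℓ + ℓ
  independent⊆N⇒∣D∣<ℓ+ℓ {ℓ} {D} K-free 1≤ℓ D-ind D⊆Nu = ≰⇒> λ ℓ+ℓ≤∣D∣ →
    K-free (ℓ≤∣NI∣⇒K 1≤ℓ (sub-ind Large⊆D) (D⊆Nu ∘ Large⊆D) (ℓ≤∣Large∣ ℓ+ℓ≤∣D∣)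
                     (proj₂ ∘ ∈-filter⁻ large?))
    where
    large? : Decidable (λ w → w ∈ D × ℓ ≤ ∣ NI w ∣)
    large? w = w ∈? D ×-dec ℓ ≤? ∣ NI w ∣
    small? : Decidable (λ w → w ∈ D × ∣ NI w ∣ < ℓ)
    small? w = w ∈? D ×-dec ∣ NI w ∣ <? ℓ
    Large Small : Subset n
    Large = filter large?
    Small = filter small?
    Large⊆D : Large ⊆ D
    Large⊆D = proj₁ ∘ ∈-filter⁻ large?
    Small⊆D : Small ⊆ D
    Small⊆D = proj₁ ∘ ∈-filter⁻ small?
    sub-ind : ∀ {J} → J ⊆ D → Independent G J
    sub-ind J⊆D x∈J y∈J = D-ind (J⊆D x∈J) (J⊆D y∈J)
    D⊆Large∪Small : D ⊆ Large ∪ Small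
    D⊆Large∪Small {w} w∈D with ℓ ≤? ∣ NI w ∣
    ... | yes ℓ≤∣NIw∣ = x∈p∪q⁺ (inj₁ (∈-filter⁺ large? (w∈D , ℓ≤∣NIw∣)))
    ... | no  ℓ≰∣NIw∣ = x∈p∪q⁺ (inj₂ (∈-filter⁺ small? (w∈D , ≰⇒> ℓ≰∣NIw∣)))
    ∣Small∣≤ℓ : ∣ Small ∣ ≤ ℓ
    ∣Small∣≤ℓ = ∣NI∣≤k⇒∣J∣≤k (sub-ind Small⊆D) (D⊆Nu ∘ Small⊆D) (<⇒≤ ∘ proj₂ ∘ ∈-filter⁻ small?)
    ℓ≤∣Large∣ : ℓ + ℓ ≤ ∣ D ∣ → ℓ ≤ ∣ Large ∣
    ℓ≤∣Large∣ ℓ+ℓ≤∣D∣ = +-cancelʳ-≤ ℓ ℓ _ (begin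
      ℓ + ℓ               ≤⟨ ℓ+ℓ≤∣D∣ ⟩
      ∣ D ∣               ≤⟨ p⊆q∪r⇒∣p∣≤∣q∣+∣r∣ D⊆Large∪Small ⟩
      ∣ Large ∣ + ∣ Small ∣ ≤⟨ +-monoʳ-≤ ∣ Large ∣ ∣Small∣≤ℓ ⟩
      ∣ Large ∣ + ℓ       ∎)
      where open ≤-Reasoning

theorem1p7 : (ℓ : ℕ) → 2 ≤ ℓ → (n : ℕ) → 1 ≤ n → (G : Graph n) →
    Free P₅ G → Free (K ℓ) G →
    Σ (Fin n) λ v → αInduced<_ G (InClosedNbhd G v) (ℓ + ℓ)
theorem1p7 ℓ 2≤ℓ n 1≤n G P₅-free K-free with maximum-independent-set G
... | I , I-max with maximum-nonempty G I-max (fromℕ< 1≤n)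
...   | u , u∈I = u , no-independent-ℓ+ℓ
  where
  open MaximumIndependentSet G P₅-free I-max u∈I
  no-independent-ℓ+ℓ : αInduced<_ G (InClosedNbhd G u) (ℓ + ℓ)
  no-independent-ℓ+ℓ independent
    with independent-family⇒subset G (closed⇒open G (≤-trans 2≤ℓ (m≤m+n ℓ ℓ)) independent)
  ... | D , D-ind , D⊆Nu , ℓ+ℓ≤∣D∣ =
    <⇒≱ (independent⊆N⇒∣D∣<ℓ+ℓ K-free (≤-trans (s≤s z≤n) 2≤ℓ) D-ind (∈N⁺ G ∘ D⊆Nu)) ℓ+ℓ≤∣D∣
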